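{- Let $\Gamma$ be a strictly Deza graph with parameters $(n,k,b,a)$ such that $k=b+1$ and $\beta(\Gamma)>1$, and let $v\in V(\Gamma)$. Then one of the following holds: (1) $B(v)\cap N(v)=\emptyset$; (2) $B(v)\subset N(v)$; (3) $|B(v)\cap N(v)|=1$.
   Context: Graphs are finite, simple, undirected. $N(v)$ is the neighbourhood of $v$. A Deza graph with parameters $(n,k,b,a)$, $b\ge a$, is a nonempty $k$-regular graph on $n$ vertices in which every pair of distinct vertices has exactly $b$ or exactly $a$ common neighbours; it is strictly Deza if it has diameter $2$ and is not strongly regular. $B(v)=\{u: |N(u)\cap N(v)|=b\}$; $\beta(\Gamma)=|B(v)|$, which is independent of $v$ for strictly Deza graphs. -}

module Defs where

open import Data.Nat using (ℕ; zero; suc; _+_; _≤_; _<_; _≡ᵇ_)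
open import Data.Bool using (Bool; true; false; if_then_else_; _∧_; not)
open import Data.Fin using (Fin; zero; suc)
open import Data.Fin.Properties using (_≟_)
open import Data.Product using (Σ; _×_; ∃; ∃-syntax)
open import Data.Sum using (_⊎_)
open import Relation.Nullary using (¬_; ⌊_⌋)
open import Relation.Binary.PropositionalEquality using (_≡_; _≢_)

record Graph (n : ℕ) : Set where
  field
    adj    : Fin n → Fin n → Bool
    sym    : ∀ u v → adj u v ≡ adj v u
    irrefl : ∀ v → adj v v ≡ false
open Graph public

card : {n : ℕ} → (Fin n → Bool) → ℕ
card {zero}  P = 0
card {suc n} P = (if P zero then 1 else 0) + card (λ i → P (suc i))

Adj : {n : ℕ} → Graph n → Fin n → Fin n → Set
Adj G u v = adj G u v ≡ true

commonNbrs : {n : ℕ} → Graph n → Fin n → Fin n → ℕ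
commonNbrs G u v = card (λ w → adj G u w ∧ adj G v w)

degree : {n : ℕ} → Graph n → Fin n → ℕ
degree G v = card (adj G v)

Regular : {n : ℕ} → Graph n → ℕ → Set
Regular G k = ∀ v → degree G v ≡ k

IsDeza : (n : ℕ) → Graph n → ℕ → ℕ → ℕ → Set
IsDeza n G k b a =
  (0 < n) × Regular G k × (a ≤ b) ×
  (∀ u v → u ≢ v → commonNbrs G u v ≡ b ⊎ commonNbrs G u v ≡ a)

Diameter2 : {n : ℕ} → Graph n → Set
Diameter2 G =
  (∀ u v → u ≢ v → Adj G u v ⊎ ∃[ w ] (Adj G u w × Adj G w v)) ×
  (∃[ u ] ∃[ v ] (u ≢ v × ¬ Adj G u v))

IsSRG : {n : ℕ} → Graph n → Set
IsSRG G = ∃[ k ] ∃[ l ] ∃[ m ]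
  (Regular G k ×
   (∀ u v → Adj G u v → commonNbrs G u v ≡ l) ×
   (∀ u v → u ≢ v → ¬ Adj G u v → commonNbrs G u v ≡ m))

IsStrictlyDeza : (n : ℕ) → Graph n → ℕ → ℕ → ℕ → Set
IsStrictlyDeza n G k b a = IsDeza n G k b a × Diameter2 G × ¬ IsSRG G

Bset : {n : ℕ} → Graph n → ℕ → Fin n → Fin n → Bool
Bset G b v u = not ⌊ u ≟ v ⌋ ∧ (commonNbrs G u v ≡ᵇ b)

-- β(Γ) computed at v, i.e. |B(v)|
betaAt : {n : ℕ} → Graph n → ℕ → Fin n → ℕ
betaAt G b v = card (Bset G b v)

BcapN : {n : ℕ} → Graph n → ℕ → Fin n → ℕ
BcapN G b v = card (λ u → Bset G b v u ∧ adj G v u)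

-- With k = b + 1, a vertex u with |N(u) ∩ N(w)| = b has exactly one neighbour outside N(w).
-- For u ∈ B(v) ∩ N(v) that neighbour is v itself, so u is adjacent to no w ∈ B(v) ∖ N(v).
-- Given such a w, every vertex of B(v) ∩ N(v) is a neighbour of v outside N(w), and
-- there is only one of those; otherwise B(v) ⊆ N(v).
module Submission where

open import Defs hiding (sym)
open import Data.Nat using (ℕ; zero; suc; _<_; _≤_; _+_; z≤n; s≤s)
open import Data.Nat.Properties
  using (≤-trans; m≤n+m; +-suc; +-comm; +-cancelˡ-≡; ≡ᵇ⇒≡; n≤1⇒n≡0∨n≡1)
open import Data.Fin using (Fin; zero; suc)
open import Data.Fin.Properties using (_≟_; suc-injective; any?)
open import Data.Sum using (_⊎_; inj₁; inj₂; [_,_])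
open import Data.Product using (_×_; _,_; proj₁; proj₂)
open import Data.Bool using (Bool; true; false; _∧_; not; T)
import Data.Bool.Properties as Bool
open import Function using (_∘_)
open import Relation.Nullary using (yes; no; ⌊_⌋; contradiction)
open import Relation.Binary.PropositionalEquality
  using (_≡_; _≢_; refl; sym; trans; cong; subst; module ≡-Reasoning)

∧-true⁻ : ∀ {x y} → x ∧ y ≡ true → x ≡ true × y ≡ true
∧-true⁻ {true} {true} _ = refl , refl

∧-true⁺ : ∀ {x y} → x ≡ true → y ≡ true → x ∧ y ≡ true
∧-true⁺ refl refl = refl

not-true⁻ : ∀ {x} → not x ≡ true → x ≡ false
not-true⁻ {false} _ = refl

not-true⁺ : ∀ {x} → x ≡ false → not x ≡ true
not-true⁺ refl = refl

card-cong : ∀ {n} {P Q : Fin n → Bool} → (∀ i → P i ≡ Q i) → card P ≡ card Q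
card-cong {zero}  P≗Q = refl
card-cong {suc n} P≗Q rewrite P≗Q zero = cong (_ +_) (card-cong (P≗Q ∘ suc))

card-split : ∀ {n} (P Q : Fin n → Bool) →
             card P ≡ card (λ i → P i ∧ Q i) + card (λ i → P i ∧ not (Q i))
card-split {zero}  P Q = refl
card-split {suc n} P Q with P zero | Q zero | card-split (P ∘ suc) (Q ∘ suc)
... | true  | true  | ih = cong suc ih
... | true  | false | ih = trans (cong suc ih) (sym (+-suc _ _))
... | false | _     | ih = ih

card-pos : ∀ {n} (P : Fin n → Bool) {i} → P i ≡ true → 1 ≤ card P
card-pos P {zero}  Pi rewrite Pi = s≤s z≤n
card-pos P {suc i} Pi = ≤-trans (card-pos (P ∘ suc) Pi) (m≤n+m _ _)

card-two : ∀ {n} (P : Fin n → Bool) {i j} → i ≢ j → P i ≡ true → P j ≡ true → 2 ≤ card P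
card-two P {zero}  {zero}  i≢j _  _  = contradiction refl i≢j
card-two P {zero}  {suc j} _   Pi Pj rewrite Pi = s≤s (card-pos (P ∘ suc) Pj)
card-two P {suc i} {zero}  _   Pi Pj rewrite Pj = s≤s (card-pos (P ∘ suc) Pi)
card-two P {suc i} {suc j} i≢j Pi Pj =
  ≤-trans (card-two (P ∘ suc) (i≢j ∘ cong suc) Pi Pj) (m≤n+m _ _)

card≤1⇒unique : ∀ {n} (P : Fin n → Bool) {i j} → card P ≤ 1 → P i ≡ true → P j ≡ true → i ≡ j
card≤1⇒unique P {i} {j} P≤1 Pi Pj with i ≟ j
... | yes i≡j = i≡j
... | no  i≢j with ≤-trans (card-two P i≢j Pi Pj) P≤1
... | s≤s ()

card≡0 : ∀ {n} (P : Fin n → Bool) → (∀ i → P i ≡ false) → card P ≡ 0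
card≡0 {zero}  P none = refl
card≡0 {suc n} P none rewrite none zero = card≡0 (P ∘ suc) (none ∘ suc)

unique⇒card≤1 : ∀ {n} (P : Fin n → Bool) → (∀ i j → P i ≡ true → P j ≡ true → i ≡ j) → card P ≤ 1
unique⇒card≤1 {zero}  P unique = z≤n
unique⇒card≤1 {suc n} P unique with P zero in P0
... | false = unique⇒card≤1 (P ∘ suc) (λ i j Pi Pj → suc-injective (unique (suc i) (suc j) Pi Pj))
... | true  = s≤s (subst (_≤ 0) (sym (card≡0 (P ∘ suc) rest)) z≤n)
  where
  rest : ∀ i → P (suc i) ≡ false
  rest i with P (suc i) in Pi
  ... | false = refl
  ... | true with () ← unique zero (suc i) P0 Pi

exclusiveNbrs : ∀ {n} → Graph n → Fin n → Fin n → Fin n → Bool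
exclusiveNbrs G u w x = adj G u x ∧ not (adj G w x)

degree-split : ∀ {n} (G : Graph n) u w →
               degree G u ≡ commonNbrs G u w + card (exclusiveNbrs G u w)
degree-split G u w = card-split (adj G u) (adj G w)

commonNbrs-sym : ∀ {n} (G : Graph n) u w → commonNbrs G u w ≡ commonNbrs G w u
commonNbrs-sym G u w = card-cong (λ x → Bool.∧-comm (adj G u x) (adj G w x))

exclusiveNbr-unique : ∀ {n} (G : Graph n) {b u w x y} →
                      degree G u ≡ suc b → commonNbrs G u w ≡ b →
                      exclusiveNbrs G u w x ≡ true → exclusiveNbrs G u w y ≡ true → x ≡ y
exclusiveNbr-unique G {b} {u} {w} deg common =
  card≤1⇒unique (exclusiveNbrs G u w) (subst (_≤ 1) (sym exactlyOne) (s≤s z≤n))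
  where
  exactlyOne : card (exclusiveNbrs G u w) ≡ 1
  exactlyOne = +-cancelˡ-≡ b _ 1 (begin
    b + card (exclusiveNbrs G u w)               ≡⟨ cong (_+ _) (sym common) ⟩
    commonNbrs G u w + card (exclusiveNbrs G u w) ≡⟨ sym (degree-split G u w) ⟩
    degree G u                                    ≡⟨ deg ⟩
    suc b                                         ≡⟨ +-comm 1 b ⟩
    b + 1                                         ∎)
    where open ≡-Reasoning

Bset-distinct : ∀ {n} (G : Graph n) {b v u} → Bset G b v u ≡ true → u ≢ v
Bset-distinct G {v = v} {u} u∈B with u ≟ v
... | no u≢v = u≢v

Bset-common : ∀ {n} (G : Graph n) {b v u} → Bset G b v u ≡ true → commonNbrs G u v ≡ b
Bset-common G {b} {v} {u} u∈B =
  ≡ᵇ⇒≡ _ _ (subst T (sym (proj₂ (∧-true⁻ {not ⌊ u ≟ v ⌋} u∈B))) _)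

module _ {n} (G : Graph n) (b : ℕ) (v : Fin n) where

  B∩N : Fin n → Bool
  B∩N u = Bset G b v u ∧ adj G v u

  B∖N : Fin n → Bool
  B∖N u = Bset G b v u ∧ not (adj G v u)

  B∖N-empty⇒B⊆N : (∀ w → B∖N w ≢ true) → ∀ u → Bset G b v u ≡ true → Adj G v u
  B∖N-empty⇒B⊆N none u u∈B with adj G v u in vu
  ... | true  = refl
  ... | false = contradiction (∧-true⁺ u∈B (not-true⁺ vu)) (none u)

  module _ (regular : Regular G (suc b)) where

    B∩N-nonadjacent-B∖N : ∀ {u w} → B∩N u ≡ true → B∖N w ≡ true → adj G w u ≡ false
    B∩N-nonadjacent-B∖N {u} {w} u∈B∩N w∈B∖N with adj G w u in wu
    ... | false = refl
    ... | true  = contradiction (sym v≡w) (Bset-distinct G w∈B)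
      where
      u∈B = proj₁ (∧-true⁻ {Bset G b v u} u∈B∩N)
      vu  = proj₂ (∧-true⁻ {Bset G b v u} u∈B∩N)
      w∈B = proj₁ (∧-true⁻ {Bset G b v w} w∈B∖N)
      vw  = not-true⁻ (proj₂ (∧-true⁻ {Bset G b v w} w∈B∖N))
      v≡w : v ≡ w
      v≡w = exclusiveNbr-unique G (regular u) (Bset-common G u∈B)
              (∧-true⁺ (trans (Graph.sym G u v) vu) (not-true⁺ (irrefl G v)))
              (∧-true⁺ (trans (Graph.sym G u w) wu) (not-true⁺ vw))

    B∩N-unique : ∀ {w} → B∖N w ≡ true → ∀ u₁ u₂ → B∩N u₁ ≡ true → B∩N u₂ ≡ true → u₁ ≡ u₂
    B∩N-unique {w} w∈B∖N u₁ u₂ u₁∈B∩N u₂∈B∩N =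
      exclusiveNbr-unique G (regular v) common (outsideNw u₁∈B∩N) (outsideNw u₂∈B∩N)
      where
      common : commonNbrs G v w ≡ b
      common = trans (commonNbrs-sym G v w)
                     (Bset-common G (proj₁ (∧-true⁻ {Bset G b v w} w∈B∖N)))
      outsideNw : ∀ {u} → B∩N u ≡ true → exclusiveNbrs G v w u ≡ true
      outsideNw {u} u∈B∩N = ∧-true⁺ (proj₂ (∧-true⁻ {Bset G b v u} u∈B∩N))
                                    (not-true⁺ (B∩N-nonadjacent-B∖N u∈B∩N w∈B∖N))

-- Only the (b + 1)-regularity of the graph is needed.
lemma3 : (n : ℕ) (G : Graph n) (k b a : ℕ) →
         IsStrictlyDeza n G k b a →
         k ≡ suc b →
         (∀ w → 1 < betaAt G b w) →
         (v : Fin n) →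
         BcapN G b v ≡ 0
         ⊎ (∀ u → Bset G b v u ≡ true → Adj G v u)
         ⊎ BcapN G b v ≡ 1
lemma3 n G k b a ((_ , regular , _) , _) refl _ v
  with any? (λ w → B∖N G b v w Bool.≟ true)
... | no  B∖N-empty      = inj₂ (inj₁ (B∖N-empty⇒B⊆N G b v (λ w w∈B∖N → B∖N-empty (w , w∈B∖N))))
... | yes (w , w∈B∖N) =
  [ inj₁ , inj₂ ∘ inj₂ ] (n≤1⇒n≡0∨n≡1 (unique⇒card≤1 (B∩N G b v) (B∩N-unique G b v regular w∈B∖N)))
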